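{- Let $p>3$ be a prime, $q=p^h$, $a,b\in\mathbb{F}_{q^2}^*$, and let $$F_{a,b}(X,Y)=\frac{(a^qX^3+X^2+b^q)(bY^3+Y+a)-(a^qY^3+Y^2+b^q)(bX^3+X+a)}{X-Y}.$$ If $F_{a,b}(X,Y)=-b(X^2+AX+BY+C)(Y^2+AY+BX+C)$ for some $A,B,C\in\overline{\mathbb{F}_q}$, then $F_{a,b}(X,Y)$ factorizes over $\overline{\mathbb{F}_q}$ into four linear factors.
   Context: $\overline{\mathbb{F}_q}$ denotes an algebraic closure of $\mathbb{F}_q$. -}

module Defs where

open import Level using (Level; _⊔_) renaming (suc to lsuc)
open import Algebra.Bundles using (CommutativeRing; Semiring)
import Algebra.Definitions.RawSemiring as RawSemiringDefs
open import Data.Nat as ℕ using (ℕ; suc)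
open import Data.List using (List; []; _∷_; length)
open import Data.Product using (∃; _,_)
open import Data.Sum using (_⊎_)
open import Relation.Nullary using (¬_)

record Field (c ℓ : Level) : Set (lsuc (c ⊔ ℓ)) where
  field
    commutativeRing : CommutativeRing c ℓ
  open CommutativeRing commutativeRing public
  field
    1≉0     : ¬ (1# ≈ 0#)
    inverse : ∀ x → ¬ (x ≈ 0#) → ∃ λ y → x * y ≈ 1#
  open RawSemiringDefs (Semiring.rawSemiring semiring) public using (_^_; _×_)

module _ {c ℓ : Level} (K : Field c ℓ) where
  open Field K

  horner : List Carrier → Carrier → Carrier
  horner []       x = 0#
  horner (c ∷ cs) x = c + x * horner cs x

  -- Every monic polynomial of degree d ≥ 1,  X^d + c_{d-1} X^{d-1} + … + c₀,
  -- has a root (here d = suc (length cs) and the lower coefficients are c ∷ cs).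
  AlgebraicallyClosed : Set (c ⊔ ℓ)
  AlgebraicallyClosed =
    ∀ (c₀ : Carrier) (cs : List Carrier) →
      ∃ λ x → x ^ suc (length cs) + horner (c₀ ∷ cs) x ≈ 0#

  HasCharacteristic : ℕ → Set ℓ
  HasCharacteristic p = p × 1# ≈ 0#

  -- Every element of K is algebraic over 𝔽_p, i.e. lies in some 𝔽_{p^n}:
  -- x^(p^(n+1)) = x for some n.  Together with AlgebraicallyClosed and
  -- characteristic p, this says K is an algebraic closure of 𝔽_p (= of 𝔽_q).
  AlgebraicOverPrimeField : ℕ → Set (c ⊔ ℓ)
  AlgebraicOverPrimeField p = ∀ x → ∃ λ n → x ^ (p ℕ.^ suc n) ≈ x

  InFq² : ℕ → Carrier → Set ℓ
  InFq² q x = x ^ (q ℕ.* q) ≈ x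

  numerator : ℕ → Carrier → Carrier → Carrier → Carrier → Carrier
  numerator q a b X Y =
      ((a ^ q) * (X ^ 3) + X ^ 2 + b ^ q) * (b * (Y ^ 3) + Y + a)
    - ((a ^ q) * (Y ^ 3) + Y ^ 2 + b ^ q) * (b * (X ^ 3) + X + a)

  record LinearForm : Set (c ⊔ ℓ) where
    constructor linear
    field
      α β γ  : Carrier
      nondeg : ¬ (α ≈ 0#) ⊎ ¬ (β ≈ 0#)

  evalLinear : LinearForm → Carrier → Carrier → Carrier
  evalLinear (linear α β γ _) X Y = α * X + β * Y + γ

{-# OPTIONS --safe #-}

-- Put Y = 0. The numerator becomes a cubic in X, while the assumed factorisation is a
-- quartic in X with leading coefficient -bB. A quartic vanishing identically has its
-- fourth finite difference 24·(leading coefficient) equal to 0, and 24 is invertible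
-- because p > 3, so B = 0. The factorisation is then -b·g(X)·g(Y) with
-- g = X² + AX + C, and g splits over the algebraically closed field.

module Submission where

open import Defs
open import Algebra.Bundles using (CommutativeRing)
open import Algebra.Solver.Ring.AlmostCommutativeRing
  using (fromCommutativeRing; _-Raw-AlmostCommutative⟶_)
open import Data.Integer as ℤ using (ℤ; +_; -[1+_]; _⊖_; sign; ∣_∣)
import Data.Integer.Properties as ℤ
open import Data.List using ([]; _∷_)
open import Data.Maybe as Maybe using (Maybe)
open import Data.Nat as ℕ using (ℕ; zero; suc; _<_; _≤_; NonZero)
open import Data.Nat.Coprimality using (prime⇒coprime; coprime-Bézout)
open import Data.Nat.GCD using (module Bézout)
open import Data.Nat.Primality using (Prime)
import Data.Nat.Properties as ℕ
open import Data.Product using (∃; _,_)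
open import Data.Sign as Sign using (Sign)
open import Data.Sum using (inj₁; inj₂)
open import Relation.Binary.Consequences using (dec⇒weaklyDec)
open import Relation.Binary.PropositionalEquality as ≡ using (_≡_)
open import Relation.Nullary using (¬_)

module IntegerCoefficients {c ℓ} (R : CommutativeRing c ℓ) where

  open CommutativeRing R
  open import Algebra.Properties.Ring ring
    using (-0#≈0#; -‿involutive; -‿+-comm; -‿distribˡ-*; -‿distribʳ-*)
  open import Algebra.Properties.CommutativeSemigroup +-commutativeSemigroup
    using (interchange)
  open import Algebra.Properties.Semiring.Mult.TCOptimised semiring
    using (_×_; 1+×; ×-homo-+; ×1-homo-*)
  open import Relation.Binary.Reasoning.Setoid setoid

  signed : Sign → Carrier → Carrier
  signed Sign.+ x = x
  signed Sign.- x = - x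

  -- With the optimised _×_, ⟦ + 0 ⟧ℤ and ⟦ + 1 ⟧ℤ are definitionally 0# and 1#.
  ⟦_⟧ℤ : ℤ → Carrier
  ⟦ i ⟧ℤ = signed (sign i) (∣ i ∣ × 1#)

  signed-cong : ∀ s {x y} → x ≈ y → signed s x ≈ signed s y
  signed-cong Sign.+ x≈y = x≈y
  signed-cong Sign.- x≈y = -‿cong x≈y

  signed-* : ∀ s t x y → signed (s Sign.* t) (x * y) ≈ signed s x * signed t y
  signed-* Sign.+ Sign.+ x y = refl
  signed-* Sign.+ Sign.- x y = -‿distribʳ-* x y
  signed-* Sign.- Sign.+ x y = -‿distribˡ-* x y
  signed-* Sign.- Sign.- x y = begin
    x * y         ≈⟨ -‿involutive (x * y) ⟨
    - - (x * y)   ≈⟨ -‿cong (-‿distribˡ-* x y) ⟩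
    - (- x * y)   ≈⟨ -‿distribʳ-* (- x) y ⟩
    - x * - y     ∎

  ◃-homo : ∀ s n → ⟦ s ℤ.◃ n ⟧ℤ ≈ signed s (n × 1#)
  ◃-homo Sign.+ zero    = refl
  ◃-homo Sign.- zero    = sym -0#≈0#
  ◃-homo Sign.+ (suc n) = refl
  ◃-homo Sign.- (suc n) = refl

  [a+x]-[a+y]≈x-y : ∀ a x y → (a + x) - (a + y) ≈ x - y
  [a+x]-[a+y]≈x-y a x y = begin
    (a + x) + - (a + y)    ≈⟨ +-congˡ (-‿+-comm a y) ⟨
    (a + x) + (- a + - y)  ≈⟨ interchange a x (- a) (- y) ⟩
    (a - a) + (x - y)      ≈⟨ +-congʳ (-‿inverseʳ a) ⟩
    0# + (x - y)           ≈⟨ +-identityˡ (x - y) ⟩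
    x - y                  ∎

  ⊖-homo : ∀ m n → ⟦ m ⊖ n ⟧ℤ ≈ m × 1# - n × 1#
  ⊖-homo m       zero    = sym (trans (+-congˡ -0#≈0#) (+-identityʳ (m × 1#)))
  ⊖-homo zero    (suc n) = sym (+-identityˡ _)
  ⊖-homo (suc m) (suc n) = begin
    ⟦ suc m ⊖ suc n ⟧ℤ                ≡⟨ ≡.cong ⟦_⟧ℤ (ℤ.[1+m]⊖[1+n]≡m⊖n m n) ⟩
    ⟦ m ⊖ n ⟧ℤ                        ≈⟨ ⊖-homo m n ⟩
    m × 1# - n × 1#                   ≈⟨ [a+x]-[a+y]≈x-y 1# (m × 1#) (n × 1#) ⟨
    (1# + m × 1#) - (1# + n × 1#)     ≈⟨ +-cong (1+× m 1#) (-‿cong (1+× n 1#)) ⟨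
    suc m × 1# - suc n × 1#           ∎

  +-homo : ∀ i j → ⟦ i ℤ.+ j ⟧ℤ ≈ ⟦ i ⟧ℤ + ⟦ j ⟧ℤ
  +-homo (+ m)    (+ n)    = ×-homo-+ 1# m n
  +-homo (+ m)    -[1+ n ] = ⊖-homo m (suc n)
  +-homo -[1+ m ] (+ n)    = trans (⊖-homo n (suc m)) (+-comm _ _)
  +-homo -[1+ m ] -[1+ n ] = begin
    - (suc (suc (m ℕ.+ n)) × 1#)        ≡⟨ ≡.cong (λ k → - (suc k × 1#)) (ℕ.+-suc m n) ⟨
    - ((suc m ℕ.+ suc n) × 1#)          ≈⟨ -‿cong (×-homo-+ 1# (suc m) (suc n)) ⟩
    - (suc m × 1# + suc n × 1#)         ≈⟨ -‿+-comm _ _ ⟨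
    - (suc m × 1#) + - (suc n × 1#)     ∎

  *-homo : ∀ i j → ⟦ i ℤ.* j ⟧ℤ ≈ ⟦ i ⟧ℤ * ⟦ j ⟧ℤ
  *-homo i j = begin
    ⟦ i ℤ.* j ⟧ℤ                                     ≈⟨ ◃-homo (sign i Sign.* sign j) (∣ i ∣ ℕ.* ∣ j ∣) ⟩
    signed (sign i Sign.* sign j) ((∣ i ∣ ℕ.* ∣ j ∣) × 1#)
      ≈⟨ signed-cong (sign i Sign.* sign j) (×1-homo-* ∣ i ∣ ∣ j ∣) ⟩
    signed (sign i Sign.* sign j) (∣ i ∣ × 1# * ∣ j ∣ × 1#)
      ≈⟨ signed-* (sign i) (sign j) _ _ ⟩
    ⟦ i ⟧ℤ * ⟦ j ⟧ℤ                                  ∎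

  -‿homo : ∀ i → ⟦ ℤ.- i ⟧ℤ ≈ - ⟦ i ⟧ℤ
  -‿homo (+ zero)  = sym -0#≈0#
  -‿homo (+ suc n) = refl
  -‿homo -[1+ n ]  = sym (-‿involutive _)

  homomorphism : ℤ.+-*-rawRing -Raw-AlmostCommutative⟶ fromCommutativeRing R
  homomorphism = record
    { ⟦_⟧    = ⟦_⟧ℤ
    ; +-homo = +-homo
    ; *-homo = *-homo
    ; -‿homo = -‿homo
    ; 0-homo = refl
    ; 1-homo = refl
    }

  coefficient≟ : ∀ i j → Maybe (⟦ i ⟧ℤ ≈ ⟦ j ⟧ℤ)
  coefficient≟ i j = Maybe.map (λ { ≡.refl → refl }) (dec⇒weaklyDec ℤ._≟_ i j)

  open import Algebra.Solver.Ring ℤ.+-*-rawRing (fromCommutativeRing R) homomorphism coefficient≟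
    public

module QuarticPolynomials {c ℓ} (R : CommutativeRing c ℓ) where

  open CommutativeRing R
  open IntegerCoefficients R
  open import Algebra.Properties.Semiring.Mult semiring using (_×_)
  open import Algebra.Properties.Semiring.Mult.TCOptimised semiring using (×ᵤ≈×)

  -- Fourth finite difference: P(4) - 4P(3) + 6P(2) - 4P(1) + P(0) = 4! · c₄.
  vanishing-quartic⇒24*leading≈0 : ∀ c₀ c₁ c₂ c₃ c₄ →
    (∀ x → c₀ + x * (c₁ + x * (c₂ + x * (c₃ + x * c₄))) ≈ 0#) →
    (24 × 1#) * c₄ ≈ 0#
  vanishing-quartic⇒24*leading≈0 c₀ c₁ c₂ c₃ c₄ P≈0 = begin
    (24 × 1#) * c₄                                      ≈⟨ *-congʳ (×ᵤ≈× 24 1#) ⟩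
    ⟦ + 24 ⟧ℤ * c₄                                      ≈⟨ difference ⟩
    (P 4 + ⟦ + 6 ⟧ℤ * P 2 + P 0) - (⟦ + 4 ⟧ℤ * P 3 + ⟦ + 4 ⟧ℤ * P 1)
      ≈⟨ +-cong (+-cong (+-cong (P≈0 _) (*-congˡ (P≈0 _))) (P≈0 _))
                (-‿cong (+-cong (*-congˡ (P≈0 _)) (*-congˡ (P≈0 _)))) ⟩
    (0# + ⟦ + 6 ⟧ℤ * 0# + 0#) - (⟦ + 4 ⟧ℤ * 0# + ⟦ + 4 ⟧ℤ * 0#)
      ≈⟨ solve 0 ((con (+ 0) :+ con (+ 6) :* con (+ 0) :+ con (+ 0))
                   :- (con (+ 4) :* con (+ 0) :+ con (+ 4) :* con (+ 0)) := con (+ 0)) refl ⟩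
    0#                                                  ∎
    where
    open import Relation.Binary.Reasoning.Setoid setoid
    P : ℕ → Carrier
    P n = let x = ⟦ + n ⟧ℤ in c₀ + x * (c₁ + x * (c₂ + x * (c₃ + x * c₄)))
    ⌜P⌝ : ∀ {m} → ℕ → (c₀ c₁ c₂ c₃ c₄ : Polynomial m) → Polynomial m
    ⌜P⌝ n c₀ c₁ c₂ c₃ c₄ = let x = con (+ n) in c₀ :+ x :* (c₁ :+ x :* (c₂ :+ x :* (c₃ :+ x :* c₄)))
    difference : ⟦ + 24 ⟧ℤ * c₄ ≈ (P 4 + ⟦ + 6 ⟧ℤ * P 2 + P 0) - (⟦ + 4 ⟧ℤ * P 3 + ⟦ + 4 ⟧ℤ * P 1)
    difference = solve 5 (λ c₀ c₁ c₂ c₃ c₄ → con (+ 24) :* c₄ :=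
      (⌜P⌝ 4 c₀ c₁ c₂ c₃ c₄ :+ con (+ 6) :* ⌜P⌝ 2 c₀ c₁ c₂ c₃ c₄ :+ ⌜P⌝ 0 c₀ c₁ c₂ c₃ c₄)
      :- (con (+ 4) :* ⌜P⌝ 3 c₀ c₁ c₂ c₃ c₄ :+ con (+ 4) :* ⌜P⌝ 1 c₀ c₁ c₂ c₃ c₄)) refl
      c₀ c₁ c₂ c₃ c₄

module FieldProperties {c ℓ} (K : Field c ℓ) where

  open Field K
  open import Algebra.Properties.Ring ring using (-0#≈0#; -‿involutive)
  open import Algebra.Properties.Semiring.Mult semiring using (×1-homo-*)
  open import Relation.Binary.Reasoning.Setoid setoid

  x*y≈0⇒y≈0 : ∀ {x y} → ¬ (x ≈ 0#) → x * y ≈ 0# → y ≈ 0#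
  x*y≈0⇒y≈0 {x} {y} x≉0 xy≈0 with inverse x x≉0
  ... | x⁻¹ , xx⁻¹≈1 = begin
    y               ≈⟨ *-identityˡ y ⟨
    1# * y          ≈⟨ *-congʳ (trans (*-comm x⁻¹ x) xx⁻¹≈1) ⟨
    (x⁻¹ * x) * y   ≈⟨ *-assoc x⁻¹ x y ⟩
    x⁻¹ * (x * y)   ≈⟨ *-congˡ xy≈0 ⟩
    x⁻¹ * 0#        ≈⟨ zeroʳ x⁻¹ ⟩
    0#              ∎

  *-preserves-≉0 : ∀ {x y} → ¬ (x ≈ 0#) → ¬ (y ≈ 0#) → ¬ (x * y ≈ 0#)
  *-preserves-≉0 x≉0 y≉0 xy≈0 = y≉0 (x*y≈0⇒y≈0 x≉0 xy≈0)

  -‿preserves-≉0 : ∀ {x} → ¬ (x ≈ 0#) → ¬ (- x ≈ 0#)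
  -‿preserves-≉0 {x} x≉0 -x≈0 = x≉0 (begin
    x       ≈⟨ -‿involutive x ⟨
    - - x   ≈⟨ -‿cong -x≈0 ⟩
    - 0#    ≈⟨ -0#≈0# ⟩
    0#      ∎)

  ×1-preserves-≈0 : ∀ m {n} → n × 1# ≈ 0# → (m ℕ.* n) × 1# ≈ 0#
  ×1-preserves-≈0 m {n} n≈0 = trans (×1-homo-* m n) (trans (*-congˡ n≈0) (zeroʳ _))

  ×1-preserves-≉0 : ∀ m n → ¬ (m × 1# ≈ 0#) → ¬ (n × 1# ≈ 0#) → ¬ ((m ℕ.* n) × 1# ≈ 0#)
  ×1-preserves-≉0 m n m≉0 n≉0 mn≈0 = *-preserves-≉0 m≉0 n≉0 (trans (sym (×1-homo-* m n)) mn≈0)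

  ×1≈0⇒suc×1≉0 : ∀ {u v} → suc u ≡ v → u × 1# ≈ 0# → ¬ (v × 1# ≈ 0#)
  ×1≈0⇒suc×1≉0 {u} {v} 1+u≡v u≈0 v≈0 = 1≉0 (begin
    1#              ≈⟨ +-identityʳ 1# ⟨
    1# + 0#         ≈⟨ +-congˡ u≈0 ⟨
    suc u × 1#      ≡⟨ ≡.cong (_× 1#) 1+u≡v ⟩
    v × 1#          ≈⟨ v≈0 ⟩
    0#              ∎)

  -- Bézout writes 1 = ±(x p - y k), so k · 1 = 0 would force 1 = 0.
  ×1≉0-below-characteristic : ∀ {p} → Prime p → HasCharacteristic K p →
    ∀ k .{{_ : NonZero k}} → k < p → ¬ (k × 1# ≈ 0#)
  ×1≉0-below-characteristic {p} p-prime char k k<p k≈0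
    with coprime-Bézout (prime⇒coprime p-prime k<p)
  ... | Bézout.+- x y eq = ×1≈0⇒suc×1≉0 eq (×1-preserves-≈0 y k≈0) (×1-preserves-≈0 x char)
  ... | Bézout.-+ x y eq = ×1≈0⇒suc×1≉0 eq (×1-preserves-≈0 x char) (×1-preserves-≈0 y k≈0)

  24×1≉0 : ∀ {p} → Prime p → 3 < p → HasCharacteristic K p → ¬ (24 × 1# ≈ 0#)
  24×1≉0 p-prime 3<p char =
    ×1-preserves-≉0 8 3 (×1-preserves-≉0 4 2 (×1-preserves-≉0 2 2 2≉0 2≉0) 2≉0) 3≉0
    where
    2≉0 : ¬ (2 × 1# ≈ 0#)
    2≉0 = ×1≉0-below-characteristic p-prime char 2 (ℕ.<-trans (ℕ.n<1+n 2) 3<p)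
    3≉0 : ¬ (3 × 1# ≈ 0#)
    3≉0 = ×1≉0-below-characteristic p-prime char 3 3<p

module AlgebraicallyClosedFields {c ℓ} (K : Field c ℓ) where

  open Field K
  open IntegerCoefficients commutativeRing using (con; _:+_; _:*_; _:-_; _:^_; _:=_; solve)
  open import Relation.Binary.Reasoning.Setoid setoid

  monic-quadratic-splits : AlgebraicallyClosed K →
    ∀ A C → ∃ λ r → ∀ X → X ^ 2 + A * X + C ≈ (X - r) * (X + (A + r))
  monic-quadratic-splits closed A C with closed C (A ∷ [])
  ... | r , root = r , λ X → begin
    X ^ 2 + A * X + C                                              ≈⟨ expand X ⟩
    (X - r) * (X + (A + r)) + (r ^ 2 + (C + r * (A + r * 0#)))     ≈⟨ +-congˡ root ⟩
    (X - r) * (X + (A + r)) + 0#                                   ≈⟨ +-identityʳ _ ⟩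
    (X - r) * (X + (A + r))                                        ∎
    where
    expand : ∀ X → X ^ 2 + A * X + C ≈ (X - r) * (X + (A + r)) + (r ^ 2 + (C + r * (A + r * 0#)))
    expand = solve 4 (λ A C r X → X :^ 2 :+ A :* X :+ C :=
      (X :- r) :* (X :+ (A :+ r)) :+ (r :^ 2 :+ (C :+ r :* (A :+ r :* con (+ 0))))) refl A C r

module QuadraticFactorisation {c ℓ} (K : Field c ℓ) where

  open Field K
  open FieldProperties K
  open QuarticPolynomials commutativeRing
  open IntegerCoefficients commutativeRing
    using (Polynomial; con; _:+_; _:*_; _:-_; :-_; _:^_; _:=_; solve)
  open import Algebra.Properties.Ring ring using (x≈y⇒x∙y⁻¹≈ε)
  open import Relation.Binary.Reasoning.Setoid setoid

  factorised : (b A B C X Y : Carrier) → Carrier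
  factorised b A B C X Y =
    (X - Y) * ((- b) * ((X ^ 2 + A * X + B * Y + C) * (Y ^ 2 + A * Y + B * X + C)))

  ⌜numerator⌝ : ∀ {n} (α β a b X Y : Polynomial n) → Polynomial n
  ⌜numerator⌝ α β a b X Y =
      (α :* (X :^ 3) :+ X :^ 2 :+ β) :* (b :* (Y :^ 3) :+ Y :+ a)
    :- (α :* (Y :^ 3) :+ Y :^ 2 :+ β) :* (b :* (X :^ 3) :+ X :+ a)

  ⌜factorised⌝ : ∀ {n} (b A B C X Y : Polynomial n) → Polynomial n
  ⌜factorised⌝ b A B C X Y =
    (X :- Y) :* ((:- b) :* ((X :^ 2 :+ A :* X :+ B :* Y :+ C) :* (Y :^ 2 :+ A :* Y :+ B :* X :+ C)))

  difference-at-Y≈0 : ∀ q a b A B C X →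
    numerator K q a b X 0# - factorised b A B C X 0# ≈
    0# + X * ((- b ^ q + b * (C * C)) + X * ((a + b * (A * C + B * C))
       + X * ((a * a ^ q - b ^ q * b + b * (C + A * B)) + X * (b * B))))
  difference-at-Y≈0 q a b = solve 8 (λ α β a b A B C X →
      ⌜numerator⌝ α β a b X (con (+ 0)) :- ⌜factorised⌝ b A B C X (con (+ 0)) :=
      con (+ 0) :+ X :* ((:- β :+ b :* (C :* C)) :+ X :* ((a :+ b :* (A :* C :+ B :* C))
        :+ X :* ((a :* α :- β :* b :+ b :* (C :+ A :* B)) :+ X :* (b :* B)))))
    refl (a ^ q) (b ^ q) a b

  cross-coefficient-vanishes : ∀ {p} → Prime p → 3 < p → HasCharacteristic K p →
    ∀ q a b A B C → ¬ (b ≈ 0#) →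
    (∀ X Y → numerator K q a b X Y ≈ factorised b A B C X Y) → B ≈ 0#
  cross-coefficient-vanishes p-prime 3<p char q a b A B C b≉0 factorisation =
    x*y≈0⇒y≈0 b≉0 (x*y≈0⇒y≈0 (24×1≉0 p-prime 3<p char)
      (vanishing-quartic⇒24*leading≈0 _ _ _ _ _ λ X →
        trans (sym (difference-at-Y≈0 q a b A B C X)) (x≈y⇒x∙y⁻¹≈ε (factorisation X 0#))))

  drop-cross-term : ∀ {B} → B ≈ 0# → ∀ A C X Y → X ^ 2 + A * X + B * Y + C ≈ X ^ 2 + A * X + C
  drop-cross-term {B} B≈0 A C X Y =
    +-congʳ (trans (+-congˡ (trans (*-congʳ B≈0) (zeroˡ Y))) (+-identityʳ _))

  lineX : (α γ : Carrier) → ¬ (α ≈ 0#) → LinearForm K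
  lineX α γ α≉0 = linear α 0# γ (inj₁ α≉0)

  lineY : Carrier → LinearForm K
  lineY γ = linear 0# 1# γ (inj₂ 1≉0)

  product-of-lines : ∀ b r s X Y →
    (X - Y) * ((- b) * (((X - r) * (X + s)) * ((Y - r) * (Y + s)))) ≈
    (X - Y) * (((- b) * X + 0# * Y + b * r) * (1# * X + 0# * Y + s)
              * (0# * X + 1# * Y + - r) * (0# * X + 1# * Y + s))
  product-of-lines = solve 5 (λ b r s X Y →
    (X :- Y) :* ((:- b) :* (((X :- r) :* (X :+ s)) :* ((Y :- r) :* (Y :+ s)))) :=
    (X :- Y) :* (((:- b) :* X :+ con (+ 0) :* Y :+ b :* r) :* (con (+ 1) :* X :+ con (+ 0) :* Y :+ s)
                 :* (con (+ 0) :* X :+ con (+ 1) :* Y :+ :- r) :* (con (+ 0) :* X :+ con (+ 1) :* Y :+ s)))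
    refl

theorem5p2 : ∀ {c ℓ} (K : Field c ℓ) → let open Field K in
    ∀ (p h : ℕ) → Prime p → 3 < p → 1 ≤ h →
    HasCharacteristic K p → AlgebraicallyClosed K → AlgebraicOverPrimeField K p →
    let q = p ℕ.^ h in
    ∀ (a b : Carrier) → InFq² K q a → ¬ (a ≈ 0#) → InFq² K q b → ¬ (b ≈ 0#) →
    ∀ (A B C : Carrier) →
    (∀ X Y → numerator K q a b X Y ≈
       (X - Y) * ((- b) * ((X ^ 2 + A * X + B * Y + C) * (Y ^ 2 + A * Y + B * X + C)))) →
    ∃ λ (L₁ : LinearForm K) → ∃ λ (L₂ : LinearForm K) →
    ∃ λ (L₃ : LinearForm K) → ∃ λ (L₄ : LinearForm K) →
      ∀ X Y → numerator K q a b X Y ≈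
        (X - Y) * (evalLinear K L₁ X Y * evalLinear K L₂ X Y * evalLinear K L₃ X Y * evalLinear K L₄ X Y)
theorem5p2 K p h p-prime 3<p _ char closed _ a b _ _ _ b≉0 A B C factorisation
  with AlgebraicallyClosedFields.monic-quadratic-splits K closed A C
... | r , split =
  lineX (- b) (b * r) (-‿preserves-≉0 b≉0) , lineX 1# (A + r) 1≉0 , lineY (- r) , lineY (A + r) ,
  λ X Y → begin
    numerator K (p ℕ.^ h) a b X Y
      ≈⟨ factorisation X Y ⟩
    factorised b A B C X Y
      ≈⟨ *-congˡ (*-congˡ (*-cong (drop-cross-term B≈0 A C X Y) (drop-cross-term B≈0 A C Y X))) ⟩
    (X - Y) * ((- b) * ((X ^ 2 + A * X + C) * (Y ^ 2 + A * Y + C)))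
      ≈⟨ *-congˡ (*-congˡ (*-cong (split X) (split Y))) ⟩
    (X - Y) * ((- b) * (((X - r) * (X + (A + r))) * ((Y - r) * (Y + (A + r)))))
      ≈⟨ product-of-lines b r (A + r) X Y ⟩
    _ ∎
  where
  open Field K
  open FieldProperties K
  open QuadraticFactorisation K
  open import Relation.Binary.Reasoning.Setoid setoid
  B≈0 : B ≈ 0#
  B≈0 = cross-coefficient-vanishes p-prime 3<p char (p ℕ.^ h) a b A B C b≉0 factorisation
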